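{- Let $b\geq 2$ be even, $k\leq n-2$, and $\mathbf{s}=s_1s_2\ldots s_k$. If $\mathbf{t}$ is the first sequence (with respect to co-Reflected Gray Code Order $\lessdot$) among the sequences of $R_n(b)$ having prefix $\mathbf{s}$, then $\mathbf{t}$ has one of the following forms: 1. $\mathbf{t}=\mathbf{s}M0\ldots0$ if $U_{k+1}$ is odd and $M$ is even; 2. $\mathbf{t}=\mathbf{s}M(M+1)0\ldots0$ if $U_{k+1}$ is odd and $M$ is odd; 3. $\mathbf{t}=\mathbf{s}0\ldots0$ if $U_{k+1}$ is even, where $M=\min\{b,\max\{s_i\}_{i=1}^k+1\}$ and $U_{k+1}=\sum_{i=1}^k[s_i\neq 0 \text{ and } s_i \text{ is even}]$ (Iverson bracket).
   Context: A restricted growth function of length $n$ is an integer sequence $s_1s_2\ldots s_n$ with $s_1=0$ and $0\leq s_{i+1}\leq \max\{s_j\}_{j=1}^i+1$ for all $1\leq i\leq n-1$; $R_n$ denotes the set of these. For an integer $b\geq 1$, $R_n(b)=\{s_1\ldots s_n\in R_n : \max_i s_i\leq b\}$. The co-Reflected Gray Code Order $\lessdot$ on $\{0,1,\ldots,m-1\}^n$ ($m\geq 2$) is defined by: $\mathbf{s}=s_1\ldots s_n \lessdot \mathbf{t}=t_1\ldots t_n$ if, for the leftmost position $k$ with $s_k\neq t_k$, either $U_k$ is even and $s_k<t_k$, or $U_k$ is odd and $s_k>t_k$, where $U_k=|\{i\in\{1,\ldots,k-1\}: s_i\neq 0,\ s_i \text{ even}\}|$. -}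

module Defs where

open import Data.Nat using (ℕ; zero; suc; _+_; _≤_; _<_; _⊔_; _⊓_; _%_)
open import Data.List using (List; []; _∷_; _++_; length; foldr)
open import Data.List.Relation.Unary.All using (All)
open import Data.Product using (_×_; ∃; ∃-syntax)
open import Data.Sum using (_⊎_)
open import Data.Unit using (⊤)
open import Relation.Binary.PropositionalEquality using (_≡_; _≢_)

Even : ℕ → Set
Even n = n % 2 ≡ 0

Odd : ℕ → Set
Odd n = n % 2 ≡ 1

nzEven : ℕ → ℕ
nzEven zero = 0
nzEven (suc x) with suc x % 2
... | zero = 1
... | suc _ = 0

-- U p = |{ i : p_i ≠ 0, p_i even }| ; for a prefix p = s_1 … s_{k-1}
-- of a sequence this is U_k.
U : List ℕ → ℕ
U [] = 0
U (x ∷ xs) = nzEven x + U xs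

maxL : List ℕ → ℕ
maxL = foldr _⊔_ 0

rgfFrom : ℕ → List ℕ → Set
rgfFrom m [] = ⊤
rgfFrom m (x ∷ xs) = (x ≤ suc m) × rgfFrom (m ⊔ x) xs

IsRGF : List ℕ → Set
IsRGF [] = ⊤
IsRGF (x ∷ xs) = (x ≡ 0) × rgfFrom x xs

InR : ℕ → ℕ → List ℕ → Set
InR n b s = (length s ≡ n) × IsRGF s × All (_≤ b) s

_⋖_ : List ℕ → List ℕ → Set
s ⋖ t = ∃[ p ] ∃[ x ] ∃[ y ] ∃[ xs ] ∃[ ys ]
  (s ≡ p ++ (x ∷ xs)) × (t ≡ p ++ (y ∷ ys)) ×
  ((Even (U p) × x < y) ⊎ (Odd (U p) × y < x))

_IsPrefixOf_ : List ℕ → List ℕ → Set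
s IsPrefixOf t = ∃[ r ] (t ≡ s ++ r)

IsFirstWithPrefix : ℕ → ℕ → List ℕ → List ℕ → Set
IsFirstWithPrefix n b s t =
  InR n b t × (s IsPrefixOf t) ×
  (∀ u → InR n b u → s IsPrefixOf u → (u ≡ t) ⊎ (t ⋖ u))

M : ℕ → List ℕ → ℕ
M b s = b ⊓ suc (maxL s)

module Submission where

-- Write t = s ++ r.  For each of the three parity cases
-- we exhibit an explicit candidate tail c (zeros, M then zeros, or M, M+1
-- then zeros), check that s ++ c lies in R_n(b), and show that t ⋖ s ++ c
-- is impossible; minimality of t then forces t ≡ s ++ c.
--
-- Because t and s ++ c share the prefix s, the comparison t ⋖ s ++ c only
-- depends on the tails r and c and on the count U s contributed by s.  We
-- therefore introduce a "shifted" order  Before u r c  (the order ⋖ after a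
-- prefix of count u) and reduce everything to it:
--   * Before commutes with common prefixes (before-++), and ⋖ is Before 0;
--   * nothing precedes a block of zeros when u is even (zeros-first);
--   * when u is odd, nothing whose head is ≤ v precedes v 0…0 for a nonzero
--     even v (peak-first), nor v (v+1) 0…0 for odd v (double-peak-first).
-- The restricted-growth and bound conditions give the head bounds needed,
-- and the membership of the candidates in R_n(b).

open import Defs
open import Data.Nat using (ℕ; zero; suc; _+_; _∸_; _≤_; _<_; _⊔_; _⊓_; _%_; z≤n; s≤s)
open import Data.Nat.Properties
open import Data.List using (List; []; _∷_; _++_; length; replicate)
open import Data.List.Properties using (length-++; length-replicate; ++-assoc)
open import Data.List.Relation.Unary.All using (All; _∷_)
open import Data.List.Relation.Unary.All.Properties using (++⁺; ++⁻ˡ; ++⁻ʳ; replicate⁺)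
open import Data.Product using (_×_; _,_; ∃-syntax)
open import Data.Sum using (_⊎_; inj₁; inj₂)
open import Data.Empty using (⊥; ⊥-elim)
open import Data.Unit using (tt)
open import Relation.Binary.PropositionalEquality
open import Relation.Nullary using (¬_)

parity : ∀ n → Even n ⊎ Odd n
parity zero = inj₁ refl
parity (suc zero) = inj₂ refl
parity (suc (suc n)) = parity n

even-odd-disjoint : ∀ n → Even n → Odd n → ⊥
even-odd-disjoint _ e o with trans (sym e) o
... | ()

odd⇒even-suc : ∀ n → Odd n → Even (suc n)
odd⇒even-suc zero ()
odd⇒even-suc (suc zero) _ = refl
odd⇒even-suc (suc (suc n)) o = odd⇒even-suc n o

odd⇒even-+1 : ∀ n → Odd n → Even (n + 1)
odd⇒even-+1 n o = subst Even (+-comm 1 n) (odd⇒even-suc n o)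

nzEven-pos-even : ∀ v → 0 < v → Even v → nzEven v ≡ 1
nzEven-pos-even (suc v) _ e with suc v % 2 | e
... | zero | _ = refl
... | suc _ | ()

nzEven-odd : ∀ v → Odd v → nzEven v ≡ 0
nzEven-odd zero _ = refl
nzEven-odd (suc v) o with suc v % 2 | o
... | suc _ | _ = refl
... | zero | ()

odd-U-nonempty : ∀ {s} → Odd (U s) → s ≢ []
odd-U-nonempty () refl

-- Ord u x y : at a first difference whose prefix has count u, entry x
-- comes before entry y.
data Ord (u x y : ℕ) : Set where
  ascending  : Even u → x < y → Ord u x y
  descending : Odd u → y < x → Ord u x y

ord-irrefl : ∀ {u x} → ¬ Ord u x x
ord-irrefl (ascending _ x<x) = <-irrefl refl x<x
ord-irrefl (descending _ x<x) = <-irrefl refl x<x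

ord-before-zero : ∀ {u x} → Ord u x 0 → Odd u
ord-before-zero (descending o _) = o

ord-odd-≤ : ∀ {u x y} → Odd u → x ≤ y → ¬ Ord u x y
ord-odd-≤ {u} o _ (ascending e _) = even-odd-disjoint u e o
ord-odd-≤ _ x≤y (descending _ y<x) = <⇒≱ y<x x≤y

-- Before u r r' : r precedes r' in the order ⋖ continued after a prefix of
-- count u.
data Before (u : ℕ) : List ℕ → List ℕ → Set where
  here  : ∀ {x y xs ys} → Ord u x y → Before u (x ∷ xs) (y ∷ ys)
  there : ∀ {x xs ys} → Before (u + nzEven x) xs ys → Before u (x ∷ xs) (x ∷ ys)

before-count : ∀ {u u' r r'} → u ≡ u' → Before u r r' → Before u' r r'
before-count refl b = b

before-at : ∀ u p {x y xs ys} → Ord (u + U p) x y → Before u (p ++ (x ∷ xs)) (p ++ (y ∷ ys))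
before-at u [] {x} {y} o = here (subst (λ w → Ord w x y) (+-identityʳ u) o)
before-at u (a ∷ p) {x} {y} o =
  there (before-at (u + nzEven a) p (subst (λ w → Ord w x y) (sym (+-assoc u (nzEven a) (U p))) o))

⋖⇒before : ∀ {s t} → s ⋖ t → Before 0 s t
⋖⇒before (p , _ , _ , _ , _ , refl , refl , inj₁ (e , x<y)) = before-at 0 p (ascending e x<y)
⋖⇒before (p , _ , _ , _ , _ , refl , refl , inj₂ (o , y<x)) = before-at 0 p (descending o y<x)

before-++ : ∀ {u} s {r r'} → Before u (s ++ r) (s ++ r') → Before (u + U s) r r'
before-++ {u} [] b = before-count (sym (+-identityʳ u)) b
before-++ (a ∷ s) (here o) = ⊥-elim (ord-irrefl o)
before-++ {u} (a ∷ s) (there b) = before-count (+-assoc u (nzEven a) (U s)) (before-++ s b)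

zeros-first : ∀ {u} → Even u → ∀ k {r} → ¬ Before u r (replicate k 0)
zeros-first {u} e (suc k) (here o) = even-odd-disjoint u e (ord-before-zero o)
zeros-first {u} e (suc k) (there b) = zeros-first e k (before-count (+-identityʳ u) b)

-- With odd count, a list with head ≤ v cannot precede v 0…0 when v is
-- nonzero and even: the heads do not decide, and after v the count is even.
peak-first : ∀ {u v x r} → Odd u → nzEven v ≡ 1 → x ≤ v →
  ∀ k → ¬ Before u (x ∷ r) (v ∷ replicate k 0)
peak-first o _ x≤v _ (here ord) = ord-odd-≤ o x≤v ord
peak-first {u} o nz _ k (there b) =
  zeros-first (odd⇒even-+1 u o) k (before-count (cong (u +_) nz) b)

-- With odd count and odd v, a list whose first two entries are bounded by
-- v and v+1 cannot precede v (v+1) 0…0: v is not counted, and v+1 is a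
-- nonzero even peak.
double-peak-first : ∀ {u v x x' r} → Odd u → Odd v → x ≤ v → x' ≤ suc v →
  ∀ k → ¬ Before u (x ∷ x' ∷ r) (v ∷ suc v ∷ replicate k 0)
double-peak-first o _ x≤v _ _ (here ord) = ord-odd-≤ o x≤v ord
double-peak-first {u} {v} o ov _ x'≤ k (there b) =
  peak-first o (nzEven-pos-even (suc v) (s≤s z≤n) (odd⇒even-suc v ov)) x'≤ k
    (before-count (trans (cong (u +_) (nzEven-odd v ov)) (+-identityʳ u)) b)

maxL-++ : ∀ s l → maxL (s ++ l) ≡ maxL s ⊔ maxL l
maxL-++ [] l = refl
maxL-++ (a ∷ s) l = trans (cong (a ⊔_) (maxL-++ s l)) (sym (⊔-assoc a (maxL s) (maxL l)))

rgfFrom-prefix : ∀ m s {r} → rgfFrom m (s ++ r) → rgfFrom m s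
rgfFrom-prefix m [] _ = tt
rgfFrom-prefix m (a ∷ s) (a≤ , h) = a≤ , rgfFrom-prefix (m ⊔ a) s h

rgfFrom-++ : ∀ m s {r} → rgfFrom m s → rgfFrom (m ⊔ maxL s) r → rgfFrom m (s ++ r)
rgfFrom-++ m [] _ h rewrite ⊔-identityʳ m = h
rgfFrom-++ m (a ∷ s) (a≤ , h) h' =
  a≤ , rgfFrom-++ (m ⊔ a) s h (subst (λ w → rgfFrom w _) (sym (⊔-assoc m a (maxL s))) h')

rgfFrom-next : ∀ m s {x xs} → rgfFrom m (s ++ (x ∷ xs)) → x ≤ suc (m ⊔ maxL s)
rgfFrom-next m [] (x≤ , _) rewrite ⊔-identityʳ m = x≤
rgfFrom-next m (a ∷ s) (_ , h) rewrite sym (⊔-assoc m a (maxL s)) = rgfFrom-next (m ⊔ a) s h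

rgf-next : ∀ s {x xs} → IsRGF (s ++ (x ∷ xs)) → x ≤ suc (maxL s)
rgf-next [] (refl , _) = z≤n
rgf-next (a ∷ s) (_ , h) = rgfFrom-next a s h

rgf-extend : ∀ s {r r'} → IsRGF (s ++ r) → rgfFrom (maxL s) r' →
  (s ≡ [] → IsRGF r') → IsRGF (s ++ r')
rgf-extend [] _ _ rgf[] = rgf[] refl
rgf-extend (a ∷ s) (a≡0 , h) h' _ = a≡0 , rgfFrom-++ a s (rgfFrom-prefix a s h) h'

rgfFrom-zeros : ∀ m k → rgfFrom m (replicate k 0)
rgfFrom-zeros m zero = tt
rgfFrom-zeros m (suc k) =
  z≤n , subst (λ w → rgfFrom w (replicate k 0)) (sym (⊔-identityʳ m)) (rgfFrom-zeros m k)

rgf-zeros : ∀ k → IsRGF (replicate k 0)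
rgf-zeros zero = tt
rgf-zeros (suc k) = refl , rgfFrom-zeros 0 k

extend-∈R : ∀ {n b} s {r r'} → InR n b (s ++ r) → length r' ≡ length r →
  rgfFrom (maxL s) r' → (s ≡ [] → IsRGF r') → All (_≤ b) r' → InR n b (s ++ r')
extend-∈R s (len , rgf , bnd) r'≡r rgf' rgf[] bnd' =
  trans (length-++ s) (trans (cong (length s +_) r'≡r) (trans (sym (length-++ s)) len)) ,
  rgf-extend s rgf rgf' rgf[] , ++⁺ (++⁻ˡ s bnd) bnd'

zeros-∈R : ∀ {n b} s {r} k → InR n b (s ++ r) → length r ≡ k →
  InR n b (s ++ replicate k 0)
zeros-∈R s k h r≡k =
  extend-∈R s h (trans (length-replicate k) (sym r≡k))
    (rgfFrom-zeros _ k) (λ _ → rgf-zeros k) (replicate⁺ k z≤n)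

peak-∈R : ∀ {n b} s {r v} k → v ≤ b → v ≤ suc (maxL s) → s ≢ [] →
  InR n b (s ++ r) → length r ≡ suc k → InR n b (s ++ (v ∷ replicate k 0))
peak-∈R s k v≤b v≤ s≢[] h r≡ =
  extend-∈R s h (trans (cong suc (length-replicate k)) (sym r≡))
    (v≤ , rgfFrom-zeros _ k) (λ s≡[] → ⊥-elim (s≢[] s≡[])) (v≤b ∷ replicate⁺ k z≤n)

double-peak-∈R : ∀ {n b} s {r v} k → suc v ≤ b → v ≤ suc (maxL s) → s ≢ [] →
  InR n b (s ++ r) → length r ≡ suc (suc k) →
  InR n b (s ++ (v ∷ suc v ∷ replicate k 0))
double-peak-∈R s {v = v} k sv≤b v≤ s≢[] h r≡ =
  extend-∈R s h (trans (cong (λ l → suc (suc l)) (length-replicate k)) (sym r≡))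
    (v≤ , s≤s (m≤n⊔m (maxL s) v) , rgfFrom-zeros _ k) (λ s≡[] → ⊥-elim (s≢[] s≡[]))
    (<⇒≤ sv≤b ∷ sv≤b ∷ replicate⁺ k z≤n)

M≤b : ∀ b s → M b s ≤ b
M≤b b s = m⊓n≤m b (suc (maxL s))

M≤suc-max : ∀ b s → M b s ≤ suc (maxL s)
M≤suc-max b s = m⊓n≤n b (suc (maxL s))

M-pos : ∀ {b} s → 0 < b → 0 < M b s
M-pos s 0<b = ⊓-glb 0<b (s≤s z≤n)

-- For even b an odd M cannot equal b, so M = max s + 1 and M + 1 ≤ b.
M-odd≢b : ∀ {b} s → Even b → Odd (M b s) → M b s ≢ b
M-odd≢b {b} s eb oM M≡b = even-odd-disjoint b eb (subst Odd M≡b oM)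

M-odd : ∀ {b} s → Even b → Odd (M b s) → M b s ≡ suc (maxL s)
M-odd {b} s eb oM with ⊓-sel b (suc (maxL s))
... | inj₁ M≡b = ⊥-elim (M-odd≢b s eb oM M≡b)
... | inj₂ M≡ = M≡

suc-M≤b : ∀ {b} s → Even b → Odd (M b s) → suc (M b s) ≤ b
suc-M≤b {b} s eb oM = ≤∧≢⇒< (M≤b b s) (M-odd≢b s eb oM)

head-≤M : ∀ {n b} s {x xs} → InR n b (s ++ (x ∷ xs)) → x ≤ M b s
head-≤M s (_ , rgf , bnd) with ++⁻ʳ s bnd
... | x≤b ∷ _ = ⊓-glb x≤b (rgf-next s rgf)

second-≤ : ∀ {n b} s {x x' xs} → InR n b (s ++ (x ∷ x' ∷ xs)) →
  M b s ≡ suc (maxL s) → x' ≤ suc (M b s)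
second-≤ {b = b} s {x} {x'} {xs} h@(_ , rgf , _) M≡ = begin
  x'                          ≤⟨ rgf-next (s ++ (x ∷ [])) rgf' ⟩
  suc (maxL (s ++ (x ∷ [])))  ≡⟨ cong suc (trans (maxL-++ s (x ∷ [])) (cong (maxL s ⊔_) (⊔-identityʳ x))) ⟩
  suc (maxL s ⊔ x)            ≤⟨ s≤s (⊔-lub (subst (maxL s ≤_) (sym M≡) (n≤1+n (maxL s))) (head-≤M s h)) ⟩
  suc (M b s)                 ∎
  where
  open ≤-Reasoning
  rgf' : IsRGF ((s ++ (x ∷ [])) ++ (x' ∷ xs))
  rgf' = subst IsRGF (sym (++-assoc s (x ∷ []) (x' ∷ xs))) rgf

first-by-tail : ∀ {n b} s {r r'} → IsFirstWithPrefix n b s (s ++ r) →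
  InR n b (s ++ r') → ¬ Before (U s) r r' → s ++ r ≡ s ++ r'
first-by-tail s (_ , _ , minimal) c∈R not-before with minimal _ c∈R (_ , refl)
... | inj₁ c≡t = sym c≡t
... | inj₂ t⋖c = ⊥-elim (not-before (before-++ s (⋖⇒before t⋖c)))

tail-shape : ∀ {n b} s {t} → InR n b t → s IsPrefixOf t → length s + 2 ≤ n →
  ∃[ x ] ∃[ x' ] ∃[ r ] (t ≡ s ++ (x ∷ x' ∷ r)) × (n ∸ length s ≡ suc (suc (length r)))
tail-shape {n} s (len , _) (r , refl) 2+s≤n =
  shape r tail-length (+-cancelˡ-≤ (length s) 2 (length r) (subst (length s + 2 ≤_) n≡ 2+s≤n))
  where
  n≡ : n ≡ length s + length r
  n≡ = trans (sym len) (length-++ s)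
  tail-length : n ∸ length s ≡ length r
  tail-length = trans (cong (_∸ length s) n≡) (m+n∸m≡n (length s) (length r))
  shape : ∀ r → n ∸ length s ≡ length r → 2 ≤ length r →
    ∃[ x ] ∃[ x' ] ∃[ r₀ ] (s ++ r ≡ s ++ (x ∷ x' ∷ r₀)) × (n ∸ length s ≡ suc (suc (length r₀)))
  shape [] _ ()
  shape (_ ∷ []) _ (s≤s ())
  shape (x ∷ x' ∷ r₀) e _ = x , x' , r₀ , refl , e

proposition4 : (n b : ℕ) (s t : List ℕ) →
    2 ≤ b → Even b → length s + 2 ≤ n →
    IsFirstWithPrefix n b s t →
    (Odd (U s) × Even (M b s) × t ≡ s ++ (M b s ∷ replicate (n ∸ length s ∸ 1) 0))
    ⊎ (Odd (U s) × Odd (M b s) × t ≡ s ++ (M b s ∷ suc (M b s) ∷ replicate (n ∸ length s ∸ 2) 0))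
    ⊎ (Even (U s) × t ≡ s ++ replicate (n ∸ length s) 0)
proposition4 n b s t 2≤b eb 2+s≤n first@(t∈R , s⊑t , _)
  with tail-shape s t∈R s⊑t 2+s≤n
... | _ , _ , r , refl , n∸s≡ rewrite n∸s≡ with parity (U s) | parity (M b s)
... | inj₁ eU | _ = inj₂ (inj₂ (eU , first-by-tail s first
        (zeros-∈R s (suc (suc (length r))) t∈R refl)
        (zeros-first eU (suc (suc (length r))))))
... | inj₂ oU | inj₁ eM = inj₁ (oU , eM , first-by-tail s first
        (peak-∈R s (suc (length r)) (M≤b b s) (M≤suc-max b s) (odd-U-nonempty oU) t∈R refl)
        (peak-first oU (nzEven-pos-even (M b s) (M-pos s (≤-trans (s≤s z≤n) 2≤b)) eM)
                    (head-≤M s t∈R) (suc (length r))))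
... | inj₂ oU | inj₂ oM = inj₂ (inj₁ (oU , oM , first-by-tail s first
        (double-peak-∈R s (length r) (suc-M≤b s eb oM) (M≤suc-max b s) (odd-U-nonempty oU) t∈R refl)
        (double-peak-first oU oM (head-≤M s t∈R) (second-≤ s t∈R (M-odd s eb oM)) (length r))))
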